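{- There exist split graphs of order $n$ with $\Omega(\sqrt{2}^{\,n})$ many minimal Roman dominating functions, and there exist cobipartite graphs of order $n$ with $\Omega(\sqrt{2}^{\,n})$ many minimal Roman dominating functions.
   Context: All graphs are finite, undirected and simple. A split graph is a graph whose vertex set can be partitioned into a clique and an independent set; a cobipartite graph is a graph whose vertex set can be partitioned into two cliques. For a graph $G=(V,E)$, a function $f\colon V\to\{0,1,2\}$ is a Roman dominating function (rdf) if every vertex $v$ with $f(v)=0$ has a neighbor $u$ with $f(u)=2$. Functions $V\to\{0,1,2\}$ are ordered pointwise: $f\le g$ iff $f(v)\le g(v)$ for all $v$. An rdf $f$ is minimal if there is no rdf $g\neq f$ with $g\le f$. -}

module Defs where

open import Data.Nat using (ℕ; _≤_)
open import Data.Fin using (Fin; zero; suc; toℕ)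
open import Data.Bool using (Bool; true; false)
open import Data.List using (List; length)
open import Data.List.Relation.Unary.All using (All)
open import Data.List.Relation.Unary.AllPairs using (AllPairs)
open import Data.Product using (Σ; ∃; ∃-syntax; _×_)
open import Relation.Nullary using (¬_)
open import Relation.Binary.PropositionalEquality using (_≡_; _≢_)

record Graph (n : ℕ) : Set₁ where
  field
    Adj   : Fin n → Fin n → Set
    sym   : ∀ {u v} → Adj u v → Adj v u
    irrefl : ∀ {v} → ¬ Adj v v
open Graph public

Labelling : ℕ → Set
Labelling n = Fin n → Fin 3

IsRDF : ∀ {n} → Graph n → Labelling n → Set
IsRDF G f = ∀ v → f v ≡ zero → ∃[ u ] (Adj G v u × f u ≡ suc (suc zero))

_≤L_ : ∀ {n} → Labelling n → Labelling n → Set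
f ≤L g = ∀ v → toℕ (f v) ≤ toℕ (g v)

IsMinimalRDF : ∀ {n} → Graph n → Labelling n → Set
IsMinimalRDF G f = IsRDF G f × (∀ g → IsRDF G g → g ≤L f → ∀ v → g v ≡ f v)

Distinct : ∀ {n} → Labelling n → Labelling n → Set
Distinct f g = ∃[ v ] (f v ≢ g v)

HasAtLeastMinRDFs : ∀ {n} → Graph n → ℕ → Set
HasAtLeastMinRDFs {n} G m =
  Σ (List (Labelling n)) λ L →
    length L ≡ m × All (IsMinimalRDF G) L × AllPairs Distinct L

IsSplit : ∀ {n} → Graph n → Set
IsSplit {n} G = Σ (Fin n → Bool) λ side →
  ((∀ u v → side u ≡ true → side v ≡ true → u ≢ v → Adj G u v) ×
   (∀ u v → side u ≡ false → side v ≡ false → ¬ Adj G u v))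

IsCobipartite : ∀ {n} → Graph n → Set
IsCobipartite {n} G = Σ (Fin n → Bool) λ side →
  (∀ u v → side u ≡ side v → u ≢ v → Adj G u v)

{-# OPTIONS --safe #-}
module Submission where

-- Take two copies t₁ … t_k and b₁ … b_k of a k-set with tᵢ bᵢ adjacent, the tᵢ forming a
-- clique and the bᵢ an independent set (split) or a second clique (cobipartite), plus
-- possibly one extra vertex to fix the parity of n. Every nonempty S ⊆ {1 … k} gives a
-- minimal rdf: tᵢ ↦ 2, bᵢ ↦ 0 for i ∈ S, and tᵢ ↦ 0, bᵢ ↦ 1 otherwise, the extra vertex ↦ 1.
-- It is minimal because bᵢ is a private neighbour of tᵢ for i ∈ S and no vertex labelled 1
-- sees a 2. Fixing 1 ∈ S already gives 2^(k-1) of them, and 2^n ≤ 9 (2^(k-1))².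

open import Defs hiding (sym)
open import Data.Nat using (ℕ; zero; suc; _≤_; _+_; _*_; _^_; z≤n; s≤s)
open import Data.Nat.Properties using (+-identityʳ; +-suc; n≤1+n; +-monoʳ-≤; *-monoˡ-≤; ^-monoʳ-≤; ^-distribˡ-+-*; module ≤-Reasoning)
open import Data.Nat.Solver using (module +-*-Solver)
open import Data.Fin using (Fin; zero; suc; toℕ)
open import Data.Fin.Patterns using (0F; 1F; 2F)
open import Data.Fin.Properties using (+↔⊎)
open import Data.Bool using (Bool; true; false; T; if_then_else_)
open import Data.Unit using (⊤; tt)
open import Data.Empty using (⊥; ⊥-elim)
open import Data.Sum using (_⊎_; inj₁; inj₂)
open import Data.Sum.Function.Propositional using (_⊎-↔_)
open import Data.List using (List; []; _∷_; map; _++_; length)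
open import Data.List.Properties using (length-map; length-++)
open import Data.List.Relation.Unary.All as All using (All)
import Data.List.Relation.Unary.All.Properties as All
open import Data.List.Relation.Unary.AllPairs as AllPairs using (AllPairs)
import Data.List.Relation.Unary.AllPairs.Properties as AllPairs
open import Data.Vec.Functional using (Vector)
import Data.Vec.Functional as Vector
open import Data.Product using (Σ; ∃; ∃-syntax; _×_; _,_)
open import Function using (_∘_; _↔_; Inverse; Injection)
open import Function.Properties.Inverse using (↔-refl; ↔-trans; ↔⇒↣)
open import Relation.Nullary using (¬_)
open import Relation.Binary.PropositionalEquality
  using (_≡_; _≢_; refl; sym; trans; cong; cong₂; subst; module ≡-Reasoning)

x≤0⇒x≡0 : ∀ {x : Fin 3} → toℕ x ≤ 0 → x ≡ 0F
x≤0⇒x≡0 {0F} _ = refl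

2≤x⇒x≡2 : ∀ {x : Fin 3} → 2 ≤ toℕ x → x ≡ 2F
2≤x⇒x≡2 {1F} (s≤s ())
2≤x⇒x≡2 {2F} _ = refl

x≤1⇒x≡1 : ∀ {x : Fin 3} → toℕ x ≤ 1 → x ≢ 0F → x ≡ 1F
x≤1⇒x≡1 {0F} _ x≢0 = ⊥-elim (x≢0 refl)
x≤1⇒x≡1 {1F} _ _   = refl
x≤1⇒x≡1 {2F} (s≤s ()) _

module _ {n : ℕ} (G : Graph n) (f : Labelling n) where

  IsPrivateNeighbour : Fin n → Fin n → Set
  IsPrivateNeighbour v w = Adj G w v × f w ≡ 0F × (∀ u → Adj G w u → f u ≡ 2F → u ≡ v)

  isMinimalRDF : IsRDF G f →
                 (∀ v u → f v ≡ 1F → Adj G v u → f u ≢ 2F) →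
                 (∀ v → f v ≡ 2F → ∃ (IsPrivateNeighbour v)) →
                 IsMinimalRDF G f
  isMinimalRDF rdf ones-unguarded twos-private = rdf , minimal
    where
    minimal : ∀ g → IsRDF G g → g ≤L f → ∀ v → g v ≡ f v
    minimal g g-rdf g≤f = pointwise
      where
      g≡2⇒f≡2 : ∀ {u} → g u ≡ 2F → f u ≡ 2F
      g≡2⇒f≡2 {u} gu≡2 = 2≤x⇒x≡2 (subst (λ x → toℕ x ≤ toℕ (f u)) gu≡2 (g≤f u))

      f≡0⇒g≡0 : ∀ {u} → f u ≡ 0F → g u ≡ 0F
      f≡0⇒g≡0 {u} fu≡0 = x≤0⇒x≡0 (subst (λ x → toℕ (g u) ≤ toℕ x) fu≡0 (g≤f u))

      pointwise : ∀ v → g v ≡ f v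
      pointwise v with f v in fv | g≤f v
      ... | 0F | gv≤0 = x≤0⇒x≡0 gv≤0
      ... | 1F | gv≤1 = x≤1⇒x≡1 gv≤1 gv≢0
        where
        gv≢0 : g v ≢ 0F
        gv≢0 gv≡0 with g-rdf v gv≡0
        ... | u , vu , gu≡2 = ones-unguarded v u fv vu (g≡2⇒f≡2 gu≡2)
      ... | 2F | _ with twos-private v fv
      ...   | w , _ , fw≡0 , only-v with g-rdf w (f≡0⇒g≡0 fw≡0)
      ...     | u , wu , gu≡2 = subst (λ x → g x ≡ 2F) (only-v u wu (g≡2⇒f≡2 gu≡2)) gu≡2

Vertex : ℕ → ℕ → Set
Vertex k r = (Fin k ⊎ Fin k) ⊎ Fin r

pattern top i   = inj₁ (inj₁ i)
pattern bot i   = inj₁ (inj₂ i)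
pattern extra e = inj₂ e

vertices : ∀ k r → Fin (k + k + r) ↔ Vertex k r
vertices k r = ↔-trans +↔⊎ (+↔⊎ ⊎-↔ ↔-refl)

-- For co = true the bottom and extra vertices form a second clique, otherwise they are independent.
Link : ∀ {k r} → Bool → Vertex k r → Vertex k r → Set
Link co (top i)   (top j)   = ⊤
Link co (top i)   (bot j)   = i ≡ j
Link co (bot i)   (top j)   = i ≡ j
Link co (top _)   (extra _) = ⊥
Link co (extra _) (top _)   = ⊥
Link co _         _         = T co

Link-sym : ∀ {k r} co {x y : Vertex k r} → Link co x y → Link co y x
Link-sym co {top _}   {top _}   l = l
Link-sym co {top _}   {bot _}   l = sym l
Link-sym co {bot _}   {top _}   l = sym l
Link-sym co {bot _}   {bot _}   l = l
Link-sym co {bot _}   {extra _} l = l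
Link-sym co {extra _} {bot _}   l = l
Link-sym co {extra _} {extra _} l = l

isTop : ∀ {k r} → Vertex k r → Bool
isTop (top _)   = true
isTop (bot _)   = false
isTop (extra _) = false

top-Link : ∀ {k r} co {x y : Vertex k r} → isTop x ≡ true → isTop y ≡ true → Link co x y
top-Link co {top _} {top _} _ _ = tt

nonTop-¬Link : ∀ {k r} {x y : Vertex k r} → isTop x ≡ false → isTop y ≡ false → ¬ Link false x y
nonTop-¬Link {x = bot _}   {bot _}   _ _ ()
nonTop-¬Link {x = bot _}   {extra _} _ _ ()
nonTop-¬Link {x = extra _} {bot _}   _ _ ()
nonTop-¬Link {x = extra _} {extra _} _ _ ()

sameSide-Link : ∀ {k r} {x y : Vertex k r} → isTop x ≡ isTop y → Link true x y
sameSide-Link {x = top _}   {top _}   _ = tt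
sameSide-Link {x = bot _}   {bot _}   _ = tt
sameSide-Link {x = bot _}   {extra _} _ = tt
sameSide-Link {x = extra _} {bot _}   _ = tt
sameSide-Link {x = extra _} {extra _} _ = tt

module _ {k r : ℕ} (b : Fin k → Bool) where

  label : Vertex k r → Fin 3
  label (top i)   = if b i then 2F else 0F
  label (bot i)   = if b i then 0F else 1F
  label (extra _) = 1F

  label≡2 : ∀ x → label x ≡ 2F → ∃[ i ] (x ≡ top i × b i ≡ true)
  label≡2 (top i) eq with b i in bi
  label≡2 (top i) refl | true = i , refl , bi
  label≡2 (bot i) eq with b i
  label≡2 (bot i) () | true
  label≡2 (bot i) () | false

  module _ (co : Bool) where

    label-dominating : ∃[ j ] b j ≡ true →
                       ∀ x → label x ≡ 0F → ∃[ y ] (x ≢ y × Link co x y × label y ≡ 2F)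
    label-dominating _ (top i) eq with b i in bi
    label-dominating _ (top i) () | true
    label-dominating (j , bj) (top i) _ | false =
      top j , (λ { refl → subst T (trans (sym bj) bi) tt }) , tt , cong (λ c → if c then 2F else 0F) bj
    label-dominating _ (bot i) eq with b i in bi
    ... | true = top i , (λ ()) , refl , cong (λ c → if c then 2F else 0F) bi
    label-dominating _ (bot i) () | false
    label-dominating _ (extra _) ()

    label-unguarded : ∀ x y → label x ≡ 1F → Link co x y → label y ≢ 2F
    label-unguarded x y lx l ly with label≡2 y ly
    ... | j , refl , bj = unguarded x lx l bj
      where
      unguarded : ∀ x → label x ≡ 1F → Link co x (top j) → b j ≡ true → ⊥
      unguarded (top i) lx _ _ with b i
      unguarded (top i) () _ _ | true
      unguarded (top i) () _ _ | false
      unguarded (bot .j) lx refl bj with b j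
      unguarded (bot .j) () refl refl | .true
      unguarded (extra _) _ () _

    label-private : ∀ x → label x ≡ 2F →
      ∃[ y ] (x ≢ y × Link co x y × label y ≡ 0F × ∀ z → Link co y z → label z ≡ 2F → z ≡ x)
    label-private x lx with label≡2 x lx
    ... | i , refl , bi = bot i , (λ ()) , refl , cong (λ c → if c then 0F else 1F) bi , only-top
      where
      only-top : ∀ z → Link co (bot i) z → label z ≡ 2F → z ≡ top i
      only-top z l lz with label≡2 z lz
      only-top z refl _ | _ , refl , _ = refl

module _ (co : Bool) {n k r : ℕ} (ι : Fin n ↔ Vertex k r) where
  open Inverse ι

  graph : Graph n
  graph = record
    { Adj    = λ u v → u ≢ v × Link co (to u) (to v)
    ; sym    = λ {u} {v} (u≢v , l) → (u≢v ∘ sym) , Link-sym co {to u} {to v} l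
    ; irrefl = λ (v≢v , _) → v≢v refl
    }

  neighbour : ∀ {v} x → to v ≢ x → Link co (to v) x → Adj graph v (from x)
  neighbour {v} x tv≢x l =
    (λ v≡x → tv≢x (trans (cong to v≡x) (strictlyInverseˡ x))) ,
    subst (Link co (to v)) (sym (strictlyInverseˡ x)) l

  from-Link : ∀ {u} x → Adj graph (from x) u → Link co x (to u)
  from-Link {u} x (_ , l) = subst (λ y → Link co y (to u)) (strictlyInverseˡ x) l

  open Injection (↔⇒↣ ι) using () renaming (injective to to-injective)

  labelling : (Fin k → Bool) → Labelling n
  labelling b = label b ∘ to

  labelling∘from : ∀ b x → labelling b (from x) ≡ label b x
  labelling∘from b x = cong (label b) (strictlyInverseˡ x)

  labelling-isMinimalRDF : ∀ b → ∃[ j ] b j ≡ true → IsMinimalRDF graph (labelling b)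
  labelling-isMinimalRDF b selected = isMinimalRDF graph (labelling b) rdf unguarded twoPrivate
    where
    rdf : IsRDF graph (labelling b)
    rdf v fv≡0 with label-dominating b co selected (to v) fv≡0
    ... | y , tv≢y , l , ly = from y , neighbour y tv≢y l , trans (labelling∘from b y) ly

    unguarded : ∀ v u → labelling b v ≡ 1F → Adj graph v u → labelling b u ≢ 2F
    unguarded v u fv (_ , l) = label-unguarded b co (to v) (to u) fv l

    twoPrivate : ∀ v → labelling b v ≡ 2F → ∃ (IsPrivateNeighbour graph (labelling b) v)
    twoPrivate v fv with label-private b co (to v) fv
    ... | y , tv≢y , l , ly , only =
      from y ,
      Graph.sym graph (neighbour y tv≢y l) ,
      trans (labelling∘from b y) ly ,
      λ u y~u fu → to-injective (only (to u) (from-Link y y~u) fu)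

  labelling-distinct : ∀ {b c} i → b i ≢ c i → Distinct (labelling b) (labelling c)
  labelling-distinct {b} {c} i bi≢ci = from (top i) , λ eq →
    bi≢ci (if-injective (trans (sym (labelling∘from b (top i))) (trans eq (labelling∘from c (top i)))))
    where
    if-injective : ∀ {x y} → (if x then 2F else 0F) ≡ (if y then 2F else 0F) → x ≡ y
    if-injective {true}  {true}  _ = refl
    if-injective {false} {false} _ = refl

module _ {n k r : ℕ} (ι : Fin n ↔ Vertex k r) where
  open Inverse ι

  isSplit : IsSplit (graph false ι)
  isSplit = isTop ∘ to ,
    (λ u v u-top v-top u≢v → u≢v , top-Link false u-top v-top) ,
    (λ u v u-bot v-bot (_ , l) → nonTop-¬Link u-bot v-bot l)

  isCobipartite : IsCobipartite (graph true ι)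
  isCobipartite = isTop ∘ to , λ u v same u≢v → u≢v , sameSide-Link same

allVectors : ∀ m → List (Vector Bool m)
allVectors zero    = Vector.[] ∷ []
allVectors (suc m) = map (true Vector.∷_) (allVectors m) ++ map (false Vector.∷_) (allVectors m)

length-allVectors : ∀ m → length (allVectors m) ≡ 2 ^ m
length-allVectors zero    = refl
length-allVectors (suc m) = begin
  length (map (true Vector.∷_) vs ++ map (false Vector.∷_) vs)
    ≡⟨ length-++ (map (true Vector.∷_) vs) ⟩
  length (map (true Vector.∷_) vs) + length (map (false Vector.∷_) vs)
    ≡⟨ cong₂ _+_ (length-map _ vs) (length-map _ vs) ⟩
  length vs + length vs
    ≡⟨ cong (λ l → l + l) (length-allVectors m) ⟩
  2 ^ m + 2 ^ m
    ≡⟨ cong (2 ^ m +_) (sym (+-identityʳ (2 ^ m))) ⟩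
  2 ^ suc m ∎
  where
  open ≡-Reasoning
  vs = allVectors m

Differ : ∀ {m} → Vector Bool m → Vector Bool m → Set
Differ xs ys = ∃[ i ] xs i ≢ ys i

allVectors-differ : ∀ m → AllPairs Differ (allVectors m)
allVectors-differ zero    = All.[] AllPairs.∷ AllPairs.[]
allVectors-differ (suc m) =
  AllPairs.++⁺ (consed (allVectors-differ m)) (consed (allVectors-differ m))
    (All.map⁺ (All.universal (λ _ → All.map⁺ (All.universal (λ _ → zero , λ ())
                                                            (allVectors m)))
                             (allVectors m)))
  where
  consed : ∀ {x} → AllPairs Differ (allVectors m) → AllPairs Differ (map (x Vector.∷_) (allVectors m))
  consed = AllPairs.map⁺ ∘ AllPairs.map (λ (i , xi≢yi) → suc i , xi≢yi)

manyMinimalRDFs : ∀ co {n k r} (ι : Fin n ↔ Vertex (suc k) r) → HasAtLeastMinRDFs (graph co ι) (2 ^ k)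
manyMinimalRDFs co {k = k} ι =
  map (labelling co ι ∘ selection) (allVectors k) ,
  trans (length-map _ (allVectors k)) (length-allVectors k) ,
  All.map⁺ (All.universal (λ xs → labelling-isMinimalRDF co ι (selection xs) (zero , refl)) (allVectors k)) ,
  AllPairs.map⁺ (AllPairs.map (λ (i , xi≢yi) → labelling-distinct co ι (suc i) xi≢yi) (allVectors-differ k))
  where
  selection : Vector Bool k → Vector Bool (suc k)
  selection = true Vector.∷_

halve : ∀ {n} → 2 ≤ n → ∃[ k ] ∃[ r ] (r ≤ 1 × suc k + suc k + r ≡ n)
halve {1} (s≤s ())
halve {2} _ = 0 , 0 , z≤n , refl
halve {3} _ = 0 , 1 , s≤s z≤n , refl
halve {suc (suc (suc (suc n)))} _ with halve {suc (suc n)} (s≤s (s≤s z≤n))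
... | k , r , r≤1 , eq =
  suc k , r , r≤1 , trans (cong (λ m → suc (m + r)) (+-suc (suc k) (suc k))) (cong (λ m → 2 + m) eq)

2^n≤9m² : ∀ k r → r ≤ 1 → 2 ^ (suc k + suc k + r) ≤ 9 * (2 ^ k) ^ 2
2^n≤9m² k r r≤1 = begin
  2 ^ (suc k + suc k + r)       ≤⟨ ^-monoʳ-≤ 2 (+-monoʳ-≤ (suc k + suc k) r≤1) ⟩
  2 ^ (suc k + suc k + 1)       ≡⟨ ^-distribˡ-+-* 2 (suc k + suc k) 1 ⟩
  2 ^ (suc k + suc k) * 2 ^ 1   ≡⟨ cong (_* 2 ^ 1) (^-distribˡ-+-* 2 (suc k) (suc k)) ⟩
  2 * a * (2 * a) * (2 * 1)     ≡⟨ solve 1 (λ a → con 2 :* a :* (con 2 :* a) :* (con 2 :* con 1)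
                                               := con 8 :* (a :* (a :* con 1))) refl a ⟩
  8 * a ^ 2                     ≤⟨ *-monoˡ-≤ (a ^ 2) (n≤1+n 8) ⟩
  9 * a ^ 2                     ∎
  where
  open ≤-Reasoning
  open +-*-Solver
  a = 2 ^ k

exponentialFamily : ∀ co (P : ∀ {n} → Graph n → Set) →
  (∀ {n k r} (ι : Fin n ↔ Vertex k r) → P (graph co ι)) →
  ∀ n → 2 ≤ n → Σ (Graph n) λ G → P G × ∃[ m ] (HasAtLeastMinRDFs G m × 2 ^ n ≤ 9 * (m ^ 2))
exponentialFamily co P P-graph n 2≤n with halve 2≤n
... | k , r , r≤1 , refl = let ι = vertices (suc k) r in
  graph co ι , P-graph ι , 2 ^ k , manyMinimalRDFs co ι , 2^n≤9m² k r r≤1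

corollary1 :
    (∃[ k ] ∃[ N ] ∀ n → N ≤ n →
      Σ (Graph n) λ G → IsSplit G × ∃[ m ] (HasAtLeastMinRDFs G m × 2 ^ n ≤ (suc k ^ 2) * (m ^ 2)))
    ×
    (∃[ k ] ∃[ N ] ∀ n → N ≤ n →
      Σ (Graph n) λ G → IsCobipartite G × ∃[ m ] (HasAtLeastMinRDFs G m × 2 ^ n ≤ (suc k ^ 2) * (m ^ 2)))
corollary1 =
  (2 , 2 , exponentialFamily false IsSplit isSplit) ,
  (2 , 2 , exponentialFamily true IsCobipartite isCobipartite)
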